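{- Let $P$ be an ASP program with weak constraints. Then the set of stable models of $P$ equals $\mathrm{SSM}(\tau^c(P))$, and for every stable model $X$ of $P$, $$Penalty(P,X)=\ln\big(W((\tau^c(P))^s)\big)-\ln\big(W_s(\tau^c(P),X)\big).$$
   Context: A literal is an atom $a$ or its classical negation $\neg a$. An ASP rule $r$ has the form $l_1\vee\cdots\vee l_k\leftarrow l_{k+1},\dots,l_m,\ not\ l_{m+1},\dots,\ not\ l_n$ with literals $l_i$; $h(r)$, $b^+(r)$, $b^-(r)$ are the head, positive body and negative body literal sets, and $body(r)$ denotes $l_{k+1},\dots,l_m,not\ l_{m+1},\dots,not\ l_n$. An interpretation is a set of literals not containing both $a$ and $\neg a$ for any atom $a$. $I\models r$ iff ($b^+(r)\subseteq I$ and $b^-(r)\cap I=\emptyset$) implies $h(r)\cap I\neq\emptyset$. For an ASP program $\Pi$ (finite set of ground rules) the GL-reduct is $\Pi^I=\{h(r)\leftarrow b^+(r) : r\in\Pi,\ b^-(r)\cap I=\emptyset\}$, and $I$ is a stable model of $\Pi$ iff $I\models\Pi^I$ and no proper subset of $I$ satisfies $\Pi^I$. An ASP program with weak constraints $P$ is a finite set of ASP rules ($P^r$) and weak constraints $:\sim body(r).\ [w]$ with real penalty $w$ ($P^c$). $X$ is a stable model of $P$ iff it is a stable model of $P^r$; $Penalty(P,X)$ is the sum of penalties of weak constraints in $P^c$ whose bodies $X$ satisfies. An LPMLN program is a finite set of weighted rules $w:r$, $r$ an ASP rule, $w$ a real number (soft) or the symbol $\alpha$ (hard); $P^s$, $P^h$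 its soft/hard rules, $\overline{P}=\{r: w:r\in P\}$, $P_I=\{w:r\in P: I\models r\}$; $I$ is a stable model of $P$ iff it is a stable model of $\overline{P_I}$; a soft stable model is a stable model satisfying all hard rules; $\mathrm{SSM}(P)$ is their set. For a set $S$ of weighted rules, $W(S)=\exp(\sum_{w:r\in S}w)$; $W_s(P,X)=\exp(\sum_{w:r\in P^s,X\models r}w)$. The translation is $\tau^c(P)=\{\alpha:r\mid r\in P^r\}\cup\{w:\ \leftarrow body(r).\mid (:\sim body(r).\ [w])\in P^c\}$. -}

module Defs where

import Level
open import Level using (Level; _⊔_) renaming (suc to lsuc)
open import Data.Product using (_×_; _,_; proj₁; proj₂; Σ)
open import Data.List using (List; []; _∷_; map; filter; foldr; _++_; mapMaybe)
open import Data.List.Relation.Unary.All using (All) renaming (all? to allDec)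
open import Data.List.Relation.Unary.Any using (Any) renaming (any? to anyDec)
open import Data.List.Relation.Binary.Subset.Propositional using (_⊆_)
open import Data.Maybe using (Maybe; just; nothing)
open import Relation.Nullary using (¬_; Dec; yes; no)
open import Relation.Nullary.Decidable using (_×-dec_; _→-dec_; ¬?)
open import Relation.Binary.PropositionalEquality using (_≡_; refl; cong)
open import Relation.Binary.Definitions using (DecidableEquality)
open import Algebra.Bundles using (AbelianGroup)
import Data.List.Membership.Propositional as MemP
import Data.List.Membership.DecPropositional as MemD

-- Weight domain: an additive abelian group (ℝ in the paper) with exp and
-- ln such that ln (exp x) = x.

record WeightDomain (ℓ : Level) : Set (lsuc ℓ) where
  field
    additive : AbelianGroup Level.zero ℓ
  open AbelianGroup additive public
  field
    exp    : Carrier → Carrier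
    ln     : Carrier → Carrier
    ln-exp : ∀ x → ln (exp x) ≈ x

  Σw : List Carrier → Carrier
  Σw = foldr _∙_ ε

  _minus_ : Carrier → Carrier → Carrier
  x minus y = x ∙ (y ⁻¹)

data Literal (A : Set) : Set where
  atom : A → Literal A
  ~_   : A → Literal A

record Rule (A : Set) : Set where
  constructor mkRule
  field
    head : List (Literal A)
    bpos : List (Literal A)
    bneg : List (Literal A)
open Rule public

-- interpretations are finite sets of literals, represented by lists
Interp : Set → Set
Interp A = List (Literal A)

module _ {A : Set} (_≟_ : DecidableEquality A) where

  _≟L_ : DecidableEquality (Literal A)
  atom a ≟L atom b with a ≟ b
  ... | yes refl = yes refl
  ... | no n = no λ { refl → n refl }
  atom a ≟L (~ b) = no λ ()
  (~ a) ≟L atom b = no λ ()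
  (~ a) ≟L (~ b) with a ≟ b
  ... | yes refl = yes refl
  ... | no n = no λ { refl → n refl }

  open MemP using (_∈_; _∉_)
  open MemD _≟L_ using (_∈?_)

  Consistent : Interp A → Set
  Consistent I = ∀ a → ¬ (atom a ∈ I × (~ a) ∈ I)

  BodySat : Interp A → Rule A → Set
  BodySat I r = All (_∈ I) (bpos r) × All (_∉ I) (bneg r)

  bodySat? : ∀ I r → Dec (BodySat I r)
  bodySat? I r = allDec (_∈? I) (bpos r) ×-dec allDec (λ l → ¬? (l ∈? I)) (bneg r)

  Satisfies : Interp A → Rule A → Set
  Satisfies I r = BodySat I r → Any (_∈ I) (head r)

  satisfies? : ∀ I r → Dec (Satisfies I r)
  satisfies? I r = bodySat? I r →-dec anyDec (_∈? I) (head r)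

  ModelOf : Interp A → List (Rule A) → Set
  ModelOf I Π = All (Satisfies I) Π

  reduct : Interp A → List (Rule A) → List (Rule A)
  reduct I Π = map (λ r → mkRule (head r) (bpos r) [])
                   (filter (λ r → allDec (λ l → ¬? (l ∈? I)) (bneg r)) Π)

  _⊂_ : Interp A → Interp A → Set
  J ⊂ I = J ⊆ I × ¬ (I ⊆ J)

  StableModel : List (Rule A) → Interp A → Set
  StableModel Π I = Consistent I × ModelOf I (reduct I Π)
                  × (∀ J → J ⊂ I → ¬ ModelOf J (reduct I Π))

record WeakConstraint (A W : Set) : Set where
  constructor mkWC
  field
    wpos   : List (Literal A)
    wneg   : List (Literal A)
    weight : W
open WeakConstraint public

wcBody : ∀ {A W} → WeakConstraint A W → Rule A
wcBody c = mkRule [] (wpos c) (wneg c)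

record WCProgram (A W : Set) : Set where
  constructor mkWCProgram
  field
    rules : List (Rule A)
    weak  : List (WeakConstraint A W)
open WCProgram public

data Weight (W : Set) : Set where
  α    : Weight W          -- hard
  soft : W → Weight W

LPMLN : Set → Set → Set
LPMLN A W = List (Weight W × Rule A)

hardPart : ∀ {A W} → LPMLN A W → List (Rule A)
hardPart = mapMaybe λ { (α , r) → just r ; (soft _ , _) → nothing }

softPart : ∀ {A W} → LPMLN A W → List (W × Rule A)
softPart = mapMaybe λ { (α , _) → nothing ; (soft w , r) → just (w , r) }

τc : ∀ {A W} → WCProgram A W → LPMLN A W
τc P = map (λ r → (α , r)) (rules P) ++ map (λ c → (soft (weight c) , wcBody c)) (weak P)

module _ {A : Set} (_≟_ : DecidableEquality A) where

  satPart : ∀ {W} → LPMLN A W → Interp A → LPMLN A W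
  satPart P I = filter (λ wr → satisfies? _≟_ I (proj₂ wr)) P

  LPStableModel : ∀ {W} → LPMLN A W → Interp A → Set
  LPStableModel P I = StableModel _≟_ (map proj₂ (satPart P I)) I

  SSM : ∀ {W} → LPMLN A W → Interp A → Set
  SSM P I = LPStableModel P I × ModelOf _≟_ I (hardPart P)

  WCStableModel : ∀ {W} → WCProgram A W → Interp A → Set
  WCStableModel P X = StableModel _≟_ (rules P) X

  module _ {ℓ} (𝕎 : WeightDomain ℓ) where
    open WeightDomain 𝕎

    Penalty : WCProgram A Carrier → Interp A → Carrier
    Penalty P X = Σw (map weight (filter (λ c → bodySat? _≟_ X (wcBody c)) (weak P)))

    Wt : List (Carrier × Rule A) → Carrier
    Wt S = exp (Σw (map proj₁ S))

    Ws : LPMLN A Carrier → Interp A → Carrier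
    Ws P X = exp (Σw (map proj₁ (filter (λ wr → satisfies? _≟_ X (proj₂ wr)) (softPart P))))

-- A soft stable model satisfies the hard rules, and so does
-- a stable model of P; for such X the rules of τᶜ(P) satisfied by X are those of P plus
-- the constraints X satisfies.  These constraints do not affect stability: one whose
-- body holds in some J ⊆ X has its body holding in X, where it is satisfied, so it is
-- never violated by such a J.  For the weights, the soft constraints split into those X
-- violates (the penalty) and those X satisfies (W_s), whence ln W minus ln W_s.
module Submission where

open import Defs
open import Level using (Level)
open import Data.Product using (_×_; _,_; proj₁; proj₂)
open import Data.List using (List; []; _∷_; map; filter; _++_)
open import Data.List.Relation.Unary.All using (All; []; _∷_) renaming (map to All-map; tabulate to All-tabulate)
open import Data.List.Relation.Unary.Any.Properties using (¬Any[])
import Data.List.Relation.Unary.All.Properties as All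
open import Data.List.Properties using (filter-++; filter-all; filter-accept; filter-reject; map-++; map-∘; map-id)
open import Data.List.Relation.Binary.Subset.Propositional using (_⊆_)
open import Data.List.Membership.Propositional using (_∉_)
open import Data.Empty using (⊥-elim)
open import Function using (_∘_; id)
open import Relation.Nullary using (yes; no)
open import Relation.Unary using (Pred; Decidable)
open import Relation.Unary.Properties using (∁?)
open import Relation.Binary.Definitions using (DecidableEquality)
open import Relation.Binary.PropositionalEquality
  using (_≡_; refl; cong; subst; trans; module ≡-Reasoning) renaming (sym to ≡-sym)
import Relation.Binary.Reasoning.Setoid as SetoidReasoning

module _ {B C : Set} {P : Pred B Level.zero} {Q : Pred C Level.zero}
         (P? : Decidable P) (f : B → C) where

  All-map-filter⁻ : ∀ xs → All Q (map f (filter P? xs)) → All (λ x → P x → Q (f x)) xs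
  All-map-filter⁻ []       _ = []
  All-map-filter⁻ (x ∷ xs) qs with P? x | qs
  ... | yes _  | q ∷ qs′ = (λ _ → q) ∷ All-map-filter⁻ xs qs′
  ... | no ¬px | qs′     = (⊥-elim ∘ ¬px) ∷ All-map-filter⁻ xs qs′

  All-map-filter⁺ : ∀ xs → All (λ x → P x → Q (f x)) xs → All Q (map f (filter P? xs))
  All-map-filter⁺ []       _          = []
  All-map-filter⁺ (x ∷ xs) (q ∷ qs) with P? x
  ... | yes px = q px ∷ All-map-filter⁺ xs qs
  ... | no _   = All-map-filter⁺ xs qs

module _ {A : Set} (_≟_ : DecidableEquality A) where

  SatisfiesReduct : Interp A → Interp A → Rule A → Set
  SatisfiesReduct X J r = All (_∉ X) (bneg r) → Satisfies _≟_ J (mkRule (head r) (bpos r) [])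

  model-reduct⁻ : ∀ X J Π → ModelOf _≟_ J (reduct _≟_ X Π) → All (SatisfiesReduct X J) Π
  model-reduct⁻ X J = All-map-filter⁻ _ _

  model-reduct⁺ : ∀ X J Π → All (SatisfiesReduct X J) Π → ModelOf _≟_ J (reduct _≟_ X Π)
  model-reduct⁺ X J = All-map-filter⁺ _ _

  stable⇒model : ∀ {Π X} → StableModel _≟_ Π X → ModelOf _≟_ X Π
  stable⇒model {Π} {X} (_ , X⊨Πˣ , _) =
    All-map (λ red (pos , neg) → red neg (pos , [])) (model-reduct⁻ X X Π X⊨Πˣ)

  SatisfiedConstraint : Interp A → Rule A → Set
  SatisfiedConstraint X r = head r ≡ [] × Satisfies _≟_ X r

  satisfiedConstraint⇒satisfiesReduct : ∀ {X J r} → J ⊆ X →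
    SatisfiedConstraint X r → SatisfiesReduct X J r
  satisfiedConstraint⇒satisfiesReduct {r = mkRule [] _ _} J⊆X (refl , X⊨r) neg (pos , _) =
    ⊥-elim (¬Any[] (X⊨r (All-map J⊆X pos , neg)))

  module _ {X : Interp A} (Rs : List (Rule A)) {Cs : List (Rule A)}
           (Cs-ok : All (SatisfiedConstraint X) Cs) where

    private
      constraints-harmless : ∀ {J} → J ⊆ X → All (SatisfiesReduct X J) Cs
      constraints-harmless J⊆X = All-map (satisfiedConstraint⇒satisfiesReduct J⊆X) Cs-ok

      reduct-++⁻ : ∀ {J} → ModelOf _≟_ J (reduct _≟_ X (Rs ++ Cs)) → ModelOf _≟_ J (reduct _≟_ X Rs)
      reduct-++⁻ {J} J⊨ = model-reduct⁺ X J Rs (All.++⁻ˡ Rs (model-reduct⁻ X J (Rs ++ Cs) J⊨))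

      reduct-++⁺ : ∀ {J} → J ⊆ X → ModelOf _≟_ J (reduct _≟_ X Rs) → ModelOf _≟_ J (reduct _≟_ X (Rs ++ Cs))
      reduct-++⁺ {J} J⊆X J⊨ =
        model-reduct⁺ X J (Rs ++ Cs) (All.++⁺ (model-reduct⁻ X J Rs J⊨) (constraints-harmless J⊆X))

    stable-++-constraints⁻ : StableModel _≟_ (Rs ++ Cs) X → StableModel _≟_ Rs X
    stable-++-constraints⁻ (consistent , X⊨ , minimal) =
      consistent , reduct-++⁻ X⊨ , λ J J⊂X J⊨ → minimal J J⊂X (reduct-++⁺ (proj₁ J⊂X) J⊨)

    stable-++-constraints⁺ : StableModel _≟_ Rs X → StableModel _≟_ (Rs ++ Cs) X
    stable-++-constraints⁺ (consistent , X⊨ , minimal) =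
      consistent , reduct-++⁺ id X⊨ , λ J J⊂X J⊨ → minimal J J⊂X (reduct-++⁻ J⊨)

weakRule : ∀ {A W} → WeakConstraint A W → Weight W × Rule A
weakRule c = soft (weight c) , wcBody c

softConstraint : ∀ {A W} → WeakConstraint A W → W × Rule A
softConstraint c = weight c , wcBody c

hardPart-τc : ∀ {A W} (P : WCProgram A W) → hardPart (τc P) ≡ rules P
hardPart-τc (mkWCProgram (r ∷ rs) ws) = cong (r ∷_) (hardPart-τc (mkWCProgram rs ws))
hardPart-τc (mkWCProgram [] [])       = refl
hardPart-τc (mkWCProgram [] (_ ∷ ws)) = hardPart-τc (mkWCProgram [] ws)

softPart-τc : ∀ {A W} (P : WCProgram A W) → softPart (τc P) ≡ map softConstraint (weak P)
softPart-τc (mkWCProgram (_ ∷ rs) ws) = softPart-τc (mkWCProgram rs ws)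
softPart-τc (mkWCProgram [] [])       = refl
softPart-τc (mkWCProgram [] (c ∷ ws)) = cong (softConstraint c ∷_) (softPart-τc (mkWCProgram [] ws))

module _ {A : Set} (_≟_ : DecidableEquality A) {W : Set} (P : WCProgram A W) (X : Interp A) where

  satisfiedConstraints : List (Rule A)
  satisfiedConstraints = map proj₂ (filter (satisfies? _≟_ X ∘ proj₂) (map weakRule (weak P)))

  satisfiedConstraints-ok : All (SatisfiedConstraint _≟_ X) satisfiedConstraints
  satisfiedConstraints-ok =
    All-map-filter⁺ _ proj₂ (map weakRule (weak P)) (All.map⁺ (All-tabulate λ _ X⊨c → refl , X⊨c))

  satPart-τc : ModelOf _≟_ X (rules P) →
    map proj₂ (satPart _≟_ (τc P) X) ≡ rules P ++ satisfiedConstraints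
  satPart-τc X⊨rules = begin
    map proj₂ (filter sat? (hard ++ weakRules))
      ≡⟨ cong (map proj₂) (filter-++ sat? hard _) ⟩
    map proj₂ (filter sat? hard ++ filter sat? weakRules)
      ≡⟨ cong (λ hs → map proj₂ (hs ++ filter sat? weakRules)) (filter-all sat? (All.map⁺ X⊨rules)) ⟩
    map proj₂ (hard ++ filter sat? weakRules)
      ≡⟨ map-++ proj₂ hard _ ⟩
    map proj₂ hard ++ satisfiedConstraints
      ≡⟨ cong (_++ satisfiedConstraints) (trans (≡-sym (map-∘ (rules P))) (map-id (rules P))) ⟩
    rules P ++ satisfiedConstraints ∎
    where
      open ≡-Reasoning
      sat? = satisfies? _≟_ X ∘ proj₂
      hard = map (α ,_) (rules P)
      weakRules = map weakRule (weak P)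

  stable⇒softStable : WCStableModel _≟_ P X → SSM _≟_ (τc P) X
  stable⇒softStable X-stable =
    subst (λ Π → StableModel _≟_ Π X) (≡-sym (satPart-τc X⊨rules))
          (stable-++-constraints⁺ _≟_ (rules P) satisfiedConstraints-ok X-stable)
    , subst (ModelOf _≟_ X) (≡-sym (hardPart-τc P)) X⊨rules
    where X⊨rules = stable⇒model _≟_ X-stable

  softStable⇒stable : SSM _≟_ (τc P) X → WCStableModel _≟_ P X
  softStable⇒stable (X-stable , X⊨hard) =
    stable-++-constraints⁻ _≟_ (rules P) satisfiedConstraints-ok
      (subst (λ Π → StableModel _≟_ Π X) (satPart-τc X⊨rules) X-stable)
    where X⊨rules = subst (ModelOf _≟_ X) (hardPart-τc P) X⊨hard

module _ {ℓ} (𝕎 : WeightDomain ℓ) where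
  open WeightDomain 𝕎
  open SetoidReasoning setoid

  Σw-map-filter-split : ∀ {B : Set} {p} {P : Pred B p} (P? : Decidable P) (f : B → Carrier) xs →
    Σw (map f xs) ≈ Σw (map f (filter P? xs)) ∙ Σw (map f (filter (∁? P?) xs))
  Σw-map-filter-split P? f [] = sym (identityˡ ε)
  Σw-map-filter-split P? f (x ∷ xs) with P? x
  ... | yes _ = begin
    f x ∙ Σw (map f xs)  ≈⟨ ∙-congˡ (Σw-map-filter-split P? f xs) ⟩
    f x ∙ (Sᵖ ∙ Sᶜ)      ≈⟨ assoc _ _ _ ⟨
    (f x ∙ Sᵖ) ∙ Sᶜ      ∎
    where Sᵖ = Σw (map f (filter P? xs)); Sᶜ = Σw (map f (filter (∁? P?) xs))
  ... | no _ = begin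
    f x ∙ Σw (map f xs)  ≈⟨ ∙-congˡ (Σw-map-filter-split P? f xs) ⟩
    f x ∙ (Sᵖ ∙ Sᶜ)      ≈⟨ assoc _ _ _ ⟨
    (f x ∙ Sᵖ) ∙ Sᶜ      ≈⟨ ∙-congʳ (comm _ _) ⟩
    (Sᵖ ∙ f x) ∙ Sᶜ      ≈⟨ assoc _ _ _ ⟩
    Sᵖ ∙ (f x ∙ Sᶜ)      ∎
    where Sᵖ = Σw (map f (filter P? xs)); Sᶜ = Σw (map f (filter (∁? P?) xs))

  ≈-ln-exp-minus : ∀ {t v s} → t ≈ v ∙ s → v ≈ ln (exp t) minus ln (exp s)
  ≈-ln-exp-minus {t} {v} {s} t≈v∙s = begin
    v                        ≈⟨ identityʳ v ⟨
    v ∙ ε                    ≈⟨ ∙-congˡ (inverseʳ s) ⟨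
    v ∙ (s ∙ s ⁻¹)           ≈⟨ assoc _ _ _ ⟨
    (v ∙ s) ∙ s ⁻¹           ≈⟨ ∙-congʳ t≈v∙s ⟨
    t ∙ s ⁻¹                 ≈⟨ ∙-cong (ln-exp t) (⁻¹-cong (ln-exp s)) ⟨
    ln (exp t) minus ln (exp s) ∎

module _ {A : Set} (_≟_ : DecidableEquality A) where

  satisfiedWeights : ∀ {W} X (ws : List (WeakConstraint A W)) →
    map proj₁ (filter (satisfies? _≟_ X ∘ proj₂) (map softConstraint ws))
      ≡ map weight (filter (∁? (bodySat? _≟_ X ∘ wcBody)) ws)
  satisfiedWeights X []       = refl
  satisfiedWeights X (c ∷ ws) with bodySat? _≟_ X (wcBody c)
  ... | yes X⊨body
    rewrite filter-reject (satisfies? _≟_ X ∘ proj₂) {softConstraint c} {map softConstraint ws}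
                          (λ X⊨c → ¬Any[] (X⊨c X⊨body))
          | filter-reject (∁? (bodySat? _≟_ X ∘ wcBody)) {c} {ws} (λ X⊭body → X⊭body X⊨body)
    = satisfiedWeights X ws
  ... | no X⊭body
    rewrite filter-accept (satisfies? _≟_ X ∘ proj₂) {softConstraint c} {map softConstraint ws}
                          (⊥-elim ∘ X⊭body)
          | filter-accept (∁? (bodySat? _≟_ X ∘ wcBody)) {c} {ws} X⊭body
    = cong (weight c ∷_) (satisfiedWeights X ws)

  penalty-τc : ∀ {ℓ} (𝕎 : WeightDomain ℓ) P X → let open WeightDomain 𝕎 in
    Penalty _≟_ 𝕎 P X ≈ ln (Wt _≟_ 𝕎 (softPart (τc P))) minus ln (Ws _≟_ 𝕎 (τc P) X)
  penalty-τc 𝕎 P X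
    rewrite softPart-τc P
          | satisfiedWeights X (weak P)
          | ≡-sym (map-∘ {g = proj₁} {f = softConstraint} (weak P))
    = ≈-ln-exp-minus 𝕎 (Σw-map-filter-split 𝕎 (bodySat? _≟_ X ∘ wcBody) weight (weak P))

proposition6p3 : ∀ {ℓ : Level} (𝕎 : WeightDomain ℓ) {A : Set} (_≟_ : DecidableEquality A)
    (P : WCProgram A (WeightDomain.Carrier 𝕎)) →
    (∀ X → (WCStableModel _≟_ P X → SSM _≟_ (τc P) X) × (SSM _≟_ (τc P) X → WCStableModel _≟_ P X))
    × (∀ X → WCStableModel _≟_ P X →
    WeightDomain._≈_ 𝕎 (Penalty _≟_ 𝕎 P X)
    (WeightDomain._minus_ 𝕎 (WeightDomain.ln 𝕎 (Wt _≟_ 𝕎 (softPart (τc P))))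
    (WeightDomain.ln 𝕎 (Ws _≟_ 𝕎 (τc P) X))))
proposition6p3 𝕎 _≟_ P =
  (λ X → stable⇒softStable _≟_ P X , softStable⇒stable _≟_ P X) , λ X _ → penalty-τc _≟_ 𝕎 P X
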